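{- Let $p$ be an odd prime and $k,\ell$ positive integers with $\ell\le k\le 2\ell$. The map $e_{p,k,\ell}:(\mathbb{Z}/p^k\mathbb{Z})^\times\to\mathbb{Z}/p^{k-\ell}\mathbb{Z}$ defined by $e_{p,k,\ell}(x):=\frac{x^{\varphi(p^\ell)}-1}{p^\ell}\pmod{p^{k-\ell}}$ is a well-defined group epimorphism from the multiplicative group $(\mathbb{Z}/p^k\mathbb{Z})^\times$ onto the additive group $\mathbb{Z}/p^{k-\ell}\mathbb{Z}$.
   Context: $\varphi$ denotes Euler's totient function; for $x\in(\mathbb{Z}/p^k\mathbb{Z})^\times$ one takes any integer representative, for which $p^\ell$ divides $x^{\varphi(p^\ell)}-1$. -}

module Defs where

open import Data.Nat using (ℕ; _∸_; _^_; _/_; _%_; NonZero)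
open import Data.Nat.Properties using (m^n≢0)
open import Data.Nat.Coprimality using (coprime?)
open import Data.List using (length; filter; upTo)

-- Euler's totient: φ(n) = #{ m ∈ {0,…,n-1} | gcd(m,n) = 1 }.
-- (For n ≥ 2, 0 is never coprime to n; for n = 1 this gives φ(1) = 1; φ(0) = 0.)
φ : ℕ → ℕ
φ n = length (filter (λ m → coprime? m n) (upTo n))

-- e_{p,k,ℓ}(x) = ((x^φ(p^ℓ) - 1) / p^ℓ) mod p^(k-ℓ), computed on an integer
-- representative x ∈ ℕ of a class of (ℤ/p^kℤ)^×; the result is the canonical
-- representative in {0,…,p^(k-ℓ)-1} of ℤ/p^(k-ℓ)ℤ.
-- (_/_ is floor division; exactness p^ℓ ∣ x^φ(p^ℓ) - 1 is part of the theorem.)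
e : (p k ℓ : ℕ) .{{_ : NonZero p}} → ℕ → ℕ
e p k ℓ x =
  _%_ (_/_ (x ^ φ (p ^ ℓ) ∸ 1) (p ^ ℓ) {{m^n≢0 p ℓ}}) (p ^ (k ∸ ℓ)) {{m^n≢0 p (k ∸ ℓ)}}

{-# OPTIONS --safe #-}
module Submission where

-- Write M = p^ℓ and N = p^(k-ℓ). Fermat's little theorem, lifted through the
-- p-th powers (the binomial expansion of (1 + p^i u)^p), gives Euler's
-- theorem x^φ(M) = 1 + M·A for x prime to p, and then e(x) = A mod N.
-- As p^k = M·N, x ≡ y (mod p^k) forces M·A ≡ M·B (mod M·N), so A ≡ B (mod N).
-- As N ∣ M (this is k ≤ 2ℓ), (1 + MA)(1 + MB) = 1 + M(A + B + MAB) gives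
-- additivity, and likewise e(g^m) ≡ m·e(g) (mod N). For odd p the same
-- lifting gives (1+p)^(p^(ℓ-1)) = 1 + p^ℓ(1 + p w), whence
-- (1+p)^φ(M) = 1 + M·c with c ≡ -1 (mod p); c is invertible modulo N, so the
-- powers of 1 + p already hit every residue modulo N.

open import Defs
open import Algebra.Bundles using (CommutativeSemiring)
open import Data.Fin.Base using (zero; suc; toℕ; inject₁; fromℕ)
open import Data.Fin.Properties using (toℕ-inject₁; toℕ-fromℕ; toℕ<n)
open import Data.List.Base using ([]; _∷_; _++_; length; filter; upTo)
open import Data.List.Properties using (filter-++; filter-accept; filter-reject; length-++; upTo-∷ʳ)
open import Data.Nat.Base
open import Data.Nat.Combinatorics
  using (_C_; nCn≡1; nC1≡n; nCk+nC[k+1]≡[n+1]C[k+1]; nCk≡n!/k![n-k]!; k![n∸k]!∣n!)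
open import Data.Nat.Coprimality
  using (Coprime; coprime?; coprime-divisor; coprime-Bézout; coprime-+; 1-coprimeTo)
  renaming (sym to coprime-sym)
open import Data.Nat.DivMod
open import Data.Nat.Divisibility
open import Data.Nat.GCD using (module Bézout)
open import Data.Nat.Primality
  using (Prime; euclidsLemma; prime⇒nonTrivial; prime⇒nonZero; prime⇒irreducible)
open import Data.Nat.Properties
open import Data.Nat.Tactic.RingSolver using (solve-∀; solve)
open import Data.Product.Base using (∃-syntax; _×_; _,_)
open import Data.Sum.Base using (inj₁; inj₂; [_,_]′)
open import Data.Vec.Functional using (Vector; init; last; tail)
open import Function.Base using (_∘_; id)
open import Relation.Binary.PropositionalEquality
open import Relation.Nullary.Negation using (contradiction)

open import Algebra.Properties.CommutativeSemiring.Binomial +-*-commutativeSemiring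
  using (theorem; binomialTerm)
open import Algebra.Properties.CommutativeSemiring.Exp +-*-commutativeSemiring
  using () renaming (_^_ to _^ˢ_; ^-distrib-* to ^ˢ-distrib-*)
open import Algebra.Properties.Monoid.Sum +-0-monoid using (sum; sum-init-last)
open import Algebra.Properties.Semiring.Mult (CommutativeSemiring.semiring +-*-commutativeSemiring)
  using () renaming (_×_ to _×ˢ_)

^ˢ≡^ : ∀ x n → x ^ˢ n ≡ x ^ n
^ˢ≡^ x zero    = refl
^ˢ≡^ x (suc n) = cong (x *_) (^ˢ≡^ x n)

×ˢ≡* : ∀ n x → n ×ˢ x ≡ n * x
×ˢ≡* zero    x = refl
×ˢ≡* (suc n) x = cong (x +_) (×ˢ≡* n x)

^-distrib-* : ∀ x y n → (x * y) ^ n ≡ x ^ n * y ^ n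
^-distrib-* x y n = begin
  (x * y) ^ n      ≡⟨ ^ˢ≡^ (x * y) n ⟨
  (x * y) ^ˢ n     ≡⟨ ^ˢ-distrib-* x y n ⟩
  x ^ˢ n * y ^ˢ n  ≡⟨ cong₂ _*_ (^ˢ≡^ x n) (^ˢ≡^ y n) ⟩
  x ^ n * y ^ n    ∎
  where open ≡-Reasoning

m^[n*o]≡[m^o]^n : ∀ m n o → m ^ (n * o) ≡ (m ^ o) ^ n
m^[n*o]≡[m^o]^n m n o = trans (cong (m ^_) (*-comm n o)) (sym (^-*-assoc m o n))

m^o≡m^n*m^[o∸n] : ∀ m {n o} → n ≤ o → m ^ o ≡ m ^ n * m ^ (o ∸ n)
m^o≡m^n*m^[o∸n] m {n} {o} n≤o = trans (cong (m ^_) (sym (m+[n∸m]≡n n≤o))) (^-distribˡ-+-* m n (o ∸ n))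

m^n∣m^o : ∀ m {n o} → n ≤ o → m ^ n ∣ m ^ o
m^n∣m^o m {n} {o} n≤o = divides (m ^ (o ∸ n)) (trans (m^o≡m^n*m^[o∸n] m n≤o) (*-comm (m ^ n) _))

m+kn≡o+jn⇒m%n≡o%n : ∀ {m o} k j n .{{_ : NonZero n}} → m + k * n ≡ o + j * n → m % n ≡ o % n
m+kn≡o+jn⇒m%n≡o%n {m} {o} k j n eq = begin
  m % n            ≡⟨ [m+kn]%n≡m%n m k n ⟨
  (m + k * n) % n  ≡⟨ cong (_% n) eq ⟩
  (o + j * n) % n  ≡⟨ [m+kn]%n≡m%n o j n ⟩
  o % n            ∎
  where open ≡-Reasoning

m%n≡o%n⇒m+[o/n]n≡o+[m/n]n : ∀ m o n .{{_ : NonZero n}} →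
                            m % n ≡ o % n → m + (o / n) * n ≡ o + (m / n) * n
m%n≡o%n⇒m+[o/n]n≡o+[m/n]n m o n eq = begin
  m + (o / n) * n                    ≡⟨ cong (_+ (o / n) * n) (m≡m%n+[m/n]*n m n) ⟩
  m % n + (m / n) * n + (o / n) * n  ≡⟨ cong (λ r → r + (m / n) * n + (o / n) * n) eq ⟩
  o % n + (m / n) * n + (o / n) * n  ≡⟨ swap (o % n) ((m / n) * n) ((o / n) * n) ⟩
  o % n + (o / n) * n + (m / n) * n  ≡⟨ cong (_+ (m / n) * n) (m≡m%n+[m/n]*n o n) ⟨
  o + (m / n) * n                    ∎
  where
  open ≡-Reasoning
  swap : ∀ a b c → a + b + c ≡ a + c + b
  swap = solve-∀

%-cong-^ : ∀ {x y} n .{{_ : NonZero n}} → x % n ≡ y % n → ∀ k → x ^ k % n ≡ y ^ k % n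
%-cong-^         n x≡y zero    = refl
%-cong-^ {x} {y} n x≡y (suc k) = begin
  (x * x ^ k) % n              ≡⟨ %-distribˡ-* x (x ^ k) n ⟩
  ((x % n) * (x ^ k % n)) % n  ≡⟨ cong₂ (λ a b → (a * b) % n) x≡y (%-cong-^ n x≡y k) ⟩
  ((y % n) * (y ^ k % n)) % n  ≡⟨ %-distribˡ-* y (y ^ k) n ⟨
  (y * y ^ k) % n              ∎
  where open ≡-Reasoning

%-cancel-*ˡ : ∀ {c a b P} m n .{{_ : NonZero m}} .{{_ : NonZero n}} .{{_ : NonZero P}} →
              P ≡ m * n → (c + m * a) % P ≡ (c + m * b) % P → a % n ≡ b % n
%-cancel-*ˡ {c} {a} {b} m n refl eq =
  m+kn≡o+jn⇒m%n≡o%n q₁ q₂ n (*-cancelˡ-≡ _ _ m (+-cancelˡ-≡ c _ _ (begin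
    c + m * (a + q₁ * n)      ≡⟨ distribute c m a q₁ n ⟩
    c + m * a + q₁ * (m * n)  ≡⟨ m%n≡o%n⇒m+[o/n]n≡o+[m/n]n (c + m * a) (c + m * b) (m * n) eq ⟩
    c + m * b + q₂ * (m * n)  ≡⟨ distribute c m b q₂ n ⟨
    c + m * (b + q₂ * n)      ∎)))
  where
  open ≡-Reasoning
  q₁ q₂ : ℕ
  q₁ = (c + m * b) / (m * n)
  q₂ = (c + m * a) / (m * n)
  distribute : ∀ c m a q n → c + m * (a + q * n) ≡ c + m * a + q * (m * n)
  distribute = solve-∀

∣⇒[m+dk]%n≡m%n : ∀ {n d} m k .{{_ : NonZero n}} → n ∣ d → (m + d * k) % n ≡ m % n
∣⇒[m+dk]%n≡m%n {n} m k (divides q refl) = begin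
  (m + q * n * k) % n    ≡⟨ cong (λ j → (m + j) % n) (regroup q n k) ⟩
  (m + (q * k) * n) % n  ≡⟨ [m+kn]%n≡m%n m (q * k) n ⟩
  m % n                  ∎
  where
  open ≡-Reasoning
  regroup : ∀ q n k → q * n * k ≡ q * k * n
  regroup = solve-∀

linear-congruence : ∀ {c n} .{{_ : NonZero n}} → Coprime c n → ∀ z → ∃[ m ] (m * c) % n ≡ z % n
linear-congruence {c} {n} c⊥n z with coprime-Bézout c⊥n
... | Bézout.+- x y 1+yn≡xc = z * x , m+kn≡o+jn⇒m%n≡o%n 0 (z * y) n (begin
  z * x * c + 0 * n  ≡⟨ solve (z ∷ x ∷ c ∷ n ∷ []) ⟩
  z * (x * c)        ≡⟨ cong (z *_) 1+yn≡xc ⟨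
  z * (1 + y * n)    ≡⟨ solve (z ∷ y ∷ n ∷ []) ⟩
  z + z * y * n      ∎)
  where open ≡-Reasoning
-- here x c ≡ -1 (mod n), so x (n - 1) inverts c
linear-congruence {c} {suc n′} c⊥n z | Bézout.-+ x y 1+xc≡yn =
  z * x * n′ , m+kn≡o+jn⇒m%n≡o%n (z * y) (z * x * c) (suc n′) (begin
    z * x * n′ * c + z * y * suc n′    ≡⟨ solve (z ∷ x ∷ n′ ∷ c ∷ y ∷ []) ⟩
    z * x * n′ * c + z * (y * suc n′)  ≡⟨ cong (λ t → z * x * n′ * c + z * t) 1+xc≡yn ⟨
    z * x * n′ * c + z * (1 + x * c)   ≡⟨ solve (z ∷ x ∷ n′ ∷ c ∷ []) ⟩
    z + z * x * c * suc n′             ∎)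
  where open ≡-Reasoning

prime>1 : ∀ {p} → Prime p → 1 < p
prime>1 {p} pr = nonTrivial⇒n>1 p {{prime⇒nonTrivial pr}}

coprime-*ʳ : ∀ {m n o} → Coprime m n → Coprime m o → Coprime m (n * o)
coprime-*ʳ m⊥n m⊥o (d∣m , d∣no) = m⊥o (d∣m , coprime-divisor d⊥n d∣no)
  where
  d⊥n : Coprime _ _
  d⊥n (e∣d , e∣n) = m⊥n (∣-trans e∣d d∣m , e∣n)

coprime-^ʳ : ∀ {m n} k → Coprime m n → Coprime m (n ^ k)
coprime-^ʳ zero    _   (_ , d∣1) = ∣1⇒≡1 d∣1
coprime-^ʳ (suc k) m⊥n = coprime-*ʳ m⊥n (coprime-^ʳ k m⊥n)

∤⇒coprime : ∀ {p m} → Prime p → p ∤ m → Coprime m p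
∤⇒coprime pr p∤m (d∣m , d∣p) with prime⇒irreducible pr d∣p
... | inj₁ d≡1 = d≡1
... | inj₂ refl = contradiction d∣m p∤m

coprime⇒∤ : ∀ {p m n} → Prime p → p ∣ n → Coprime m n → p ∤ m
coprime⇒∤ pr p∣n m⊥n p∣m = <⇒≢ (prime>1 pr) (sym (m⊥n (p∣m , p∣n)))

prime∤m! : ∀ {p m} → Prime p → m < p → p ∤ m !
prime∤m! {m = zero}  pr _   = >⇒∤ (prime>1 pr)
prime∤m! {m = suc m} pr m<p p∣m! with euclidsLemma (suc m) (m !) pr p∣m!
... | inj₁ p∣1+m = >⇒∤ m<p p∣1+m
... | inj₂ p∣m!  = prime∤m! pr (<-trans (n<1+n m) m<p) p∣m!

nCk*[k!*[n∸k]!]≡n! : ∀ {n k} → k ≤ n → (n C k) * (k ! * (n ∸ k) !) ≡ n !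
nCk*[k!*[n∸k]!]≡n! {n} {k} k≤n = begin
  (n C k) * d    ≡⟨ cong (_* d) (nCk≡n!/k![n-k]! k≤n) ⟩
  (n ! / d) * d  ≡⟨ m/n*n≡m (k![n∸k]!∣n! k≤n) ⟩
  n !            ∎
  where
  open ≡-Reasoning
  d = k ! * (n ∸ k) !
  instance _ = k !* (n ∸ k) !≢0

prime∣pCk : ∀ {p k} → Prime p → 0 < k → k < p → p ∣ p C k
prime∣pCk {zero}  ()
prime∣pCk {suc n} {k} pr 0<k k<p =
  [ id , (λ p∣ → contradiction p∣ p∤k!*[p∸k]!) ]′ (euclidsLemma _ _ pr p∣pCk*k!*[p∸k]!)
  where
  p∣pCk*k!*[p∸k]! : suc n ∣ (suc n C k) * (k ! * (suc n ∸ k) !)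
  p∣pCk*k!*[p∸k]! = subst (suc n ∣_) (sym (nCk*[k!*[n∸k]!]≡n! (<⇒≤ k<p))) (m∣m*n (n !))
  p∤k!*[p∸k]! : suc n ∤ k ! * (suc n ∸ k) !
  p∤k!*[p∸k]! p∣ = [ prime∤m! pr k<p , prime∤m! pr (∸-monoʳ-< 0<k (<⇒≤ k<p)) ]′ (euclidsLemma _ _ pr p∣)

∣-sum : ∀ {d n} (f : Vector ℕ n) → (∀ i → d ∣ f i) → d ∣ sum f
∣-sum {n = zero}  f d∣f = _ ∣0
∣-sum {n = suc n} f d∣f = ∣m∣n⇒∣m+n (d∣f zero) (∣-sum (tail f) (d∣f ∘ suc))

binomialTerm[1,x] : ∀ x n k → binomialTerm 1 x n k ≡ (n C toℕ k) * x ^ (n ∸ toℕ k)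
binomialTerm[1,x] x n k = begin
  (n C toℕ k) ×ˢ (1 ^ˢ toℕ k * x ^ˢ (n ∸ toℕ k)) ≡⟨ ×ˢ≡* (n C toℕ k) _ ⟩
  (n C toℕ k) * (1 ^ˢ toℕ k * x ^ˢ (n ∸ toℕ k))  ≡⟨ cong₂ (λ a b → (n C toℕ k) * (a * b)) 1^ˢk≡1 (^ˢ≡^ x (n ∸ toℕ k)) ⟩
  (n C toℕ k) * (1 * x ^ (n ∸ toℕ k))           ≡⟨ cong ((n C toℕ k) *_) (*-identityˡ _) ⟩
  (n C toℕ k) * x ^ (n ∸ toℕ k)                 ∎
  where
  open ≡-Reasoning
  1^ˢk≡1 : 1 ^ˢ toℕ k ≡ 1
  1^ˢk≡1 = trans (^ˢ≡^ 1 (toℕ k)) (^-zeroˡ (toℕ k))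

freshmans-dream : ∀ {p} → Prime p → ∀ x → ∃[ q ] (1 + x) ^ p ≡ x ^ p + q * p + 1
freshmans-dream {zero} ()
freshmans-dream {suc n} pr x = q , (begin
  (1 + x) ^ suc n                                 ≡⟨ ^ˢ≡^ (1 + x) (suc n) ⟨
  (1 + x) ^ˢ suc n                                ≡⟨ theorem (suc n) 1 x ⟩
  t zero + sum (tail t)                           ≡⟨ cong (t zero +_) (sum-init-last (tail t)) ⟩
  t zero + (sum (init (tail t)) + last (tail t))  ≡⟨ cong₂ (λ a b → t zero + (a + b)) middle≡q*p last≡1 ⟩
  t zero + (q * suc n + 1)                        ≡⟨ cong (_+ (q * suc n + 1)) first≡x^p ⟩
  x ^ suc n + (q * suc n + 1)                     ≡⟨ +-assoc (x ^ suc n) _ 1 ⟨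
  x ^ suc n + q * suc n + 1                       ∎)
  where
  open ≡-Reasoning
  t : Vector ℕ (suc (suc n))
  t = binomialTerm 1 x (suc n)
  first≡x^p : t zero ≡ x ^ suc n
  first≡x^p = trans (binomialTerm[1,x] x (suc n) zero) (*-identityˡ _)
  last≡1 : last (tail t) ≡ 1
  last≡1 = begin
    last (tail t)                      ≡⟨ binomialTerm[1,x] x (suc n) (suc (fromℕ n)) ⟩
    (suc n C suc k) * x ^ (n ∸ k)      ≡⟨ cong (λ j → (suc n C suc j) * x ^ (n ∸ j)) (toℕ-fromℕ n) ⟩
    (suc n C suc n) * x ^ (n ∸ n)      ≡⟨ cong₂ (λ a b → a * x ^ b) (nCn≡1 (suc n)) (n∸n≡0 n) ⟩
    1 * 1                              ∎
    where k = toℕ (fromℕ n)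
  p∣middle : suc n ∣ sum (init (tail t))
  p∣middle = ∣-sum (init (tail t)) λ i →
    subst (suc n ∣_) (sym (binomialTerm[1,x] x (suc n) (suc (inject₁ i))))
      (∣-trans (prime∣pCk pr z<s (s<s (subst (_< n) (sym (toℕ-inject₁ i)) (toℕ<n i)))) (m∣m*n _))
  q : ℕ
  q = quotient p∣middle
  middle≡q*p : sum (init (tail t)) ≡ q * suc n
  middle≡q*p = m∣n⇒n≡quotient*m p∣middle

fermat : ∀ {p} → Prime p → ∀ x → ∃[ q ] x ^ p ≡ x + q * p
fermat {zero}  ()
fermat {suc n} pr zero    = 0 , refl
fermat {suc n} pr (suc x) with freshmans-dream pr x | fermat pr x
... | q , [1+x]^p≡x^p+qp+1 | q′ , x^p≡x+q′p = q′ + q , (begin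
    (1 + x) ^ suc n                   ≡⟨ [1+x]^p≡x^p+qp+1 ⟩
    x ^ suc n + q * suc n + 1         ≡⟨ cong (λ a → a + q * suc n + 1) x^p≡x+q′p ⟩
    x + q′ * suc n + q * suc n + 1    ≡⟨ solve (x ∷ q′ ∷ q ∷ n ∷ []) ⟩
    1 + x + (q′ + q) * suc n          ∎)
  where open ≡-Reasoning

x^p≡x⇒x^[p∸1]≡1 : ∀ {p x} → Prime p → p ∤ x → ∃[ q ] x ^ p ≡ x + q * p → ∃[ t ] x ^ (p ∸ 1) ≡ 1 + p * t
x^p≡x⇒x^[p∸1]≡1 {zero}  ()
x^p≡x⇒x^[p∸1]≡1 {suc n} {zero}   pr p∤x _ = contradiction (suc n ∣0) p∤x
x^p≡x⇒x^[p∸1]≡1 {suc n} {suc x′} pr p∤x (q , x^p≡x+qp) =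
  quotient p∣y , trans x^n≡1+y (cong suc (trans (m∣n⇒n≡quotient*m p∣y) (*-comm _ (suc n))))
  where
  x y : ℕ
  x = suc x′
  y = pred (x ^ n)
  x^n≡1+y : x ^ n ≡ 1 + y
  x^n≡1+y = sym (suc-pred (x ^ n) {{m^n≢0 x n}})
  x*y≡q*p : x * y ≡ q * suc n
  x*y≡q*p = +-cancelˡ-≡ x _ _ (begin
    x + x * y      ≡⟨ *-suc x y ⟨
    x * suc y      ≡⟨ cong (x *_) x^n≡1+y ⟨
    x ^ suc n      ≡⟨ x^p≡x+qp ⟩
    x + q * suc n  ∎)
    where open ≡-Reasoning
  p∣y : suc n ∣ y
  p∣y = [ (λ p∣x → contradiction p∣x p∤x) , id ]′ (euclidsLemma x y pr (divides q x*y≡q*p))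

fermat-little : ∀ {p x} → Prime p → p ∤ x → ∃[ t ] x ^ (p ∸ 1) ≡ 1 + p * t
fermat-little {x = x} pr p∤x = x^p≡x⇒x^[p∸1]≡1 pr p∤x (fermat pr x)

binomial-second-order : ∀ y m → ∃[ r ] (1 + y) ^ m ≡ 1 + m * y + (m C 2) * (y * y) + r * (y * y * y)
binomial-second-order y zero    = 0 , refl
binomial-second-order y (suc m) with binomial-second-order y m
... | r , [1+y]^m≡ = r + m C 2 + r * y , (begin
  (1 + y) * (1 + y) ^ m
    ≡⟨ cong ((1 + y) *_) [1+y]^m≡ ⟩
  (1 + y) * (1 + m * y + (m C 2) * (y * y) + r * (y * y * y))
    ≡⟨ expand y m (m C 2) r ⟩
  1 + suc m * y + (m + m C 2) * (y * y) + (r + m C 2 + r * y) * (y * y * y)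
    ≡⟨ cong (λ c → 1 + suc m * y + c * (y * y) + (r + m C 2 + r * y) * (y * y * y)) pascal ⟩
  1 + suc m * y + (suc m C 2) * (y * y) + (r + m C 2 + r * y) * (y * y * y)
    ∎)
  where
  open ≡-Reasoning
  pascal : m + m C 2 ≡ suc m C 2
  pascal = trans (cong (_+ m C 2) (sym (nC1≡n m))) (nCk+nC[k+1]≡[n+1]C[k+1] m 1)
  expand : ∀ y m c r → (1 + y) * (1 + m * y + c * (y * y) + r * (y * y * y))
                     ≡ 1 + (1 + m) * y + (m + c) * (y * y) + (r + c + r * y) * (y * y * y)
  expand = solve-∀

binomial-first-order : ∀ y m → ∃[ s ] (1 + y) ^ m ≡ 1 + y * (m + y * s)
binomial-first-order y m with binomial-second-order y m
... | r , [1+y]^m≡ = m C 2 + r * y , trans [1+y]^m≡ (factor-y y m (m C 2) r)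
  where
  factor-y : ∀ y m c r → 1 + m * y + c * (y * y) + r * (y * y * y) ≡ 1 + y * (m + y * (c + r * y))
  factor-y = solve-∀

-- For odd p, p ∣ p C 2 pushes the quadratic term of the expansion into p^(i+3).
lift-exponent-step : ∀ {p} → p ∣ p C 2 → ∀ i u → ∃[ w ] (1 + p ^ suc i * u) ^ p ≡ 1 + p ^ suc (suc i) * (u + p * w)
lift-exponent-step {p} (divides h pC2≡h*p) i u with binomial-second-order (p ^ suc i * u) p
... | r , [1+y]^p≡ = h * p ^ i * u * u + r * p ^ i * p ^ i * u * u * u , (begin
  (1 + y) ^ p
    ≡⟨ [1+y]^p≡ ⟩
  1 + p * y + (p C 2) * (y * y) + r * (y * y * y)
    ≡⟨ cong (λ c → 1 + p * y + c * (y * y) + r * (y * y * y)) pC2≡h*p ⟩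
  1 + p * y + (h * p) * (y * y) + r * (y * y * y)
    ≡⟨ regroup p (p ^ i) u h r ⟩
  1 + p * (p * p ^ i) * (u + p * (h * p ^ i * u * u + r * p ^ i * p ^ i * u * u * u))
    ∎)
  where
  open ≡-Reasoning
  y : ℕ
  y = p ^ suc i * u
  regroup : ∀ p P u h r → let y = p * P * u in
    1 + p * y + (h * p) * (y * y) + r * (y * y * y) ≡ 1 + p * (p * P) * (u + p * (h * P * u * u + r * P * P * u * u * u))
  regroup = solve-∀

lift-exponent : ∀ {p} → p ∣ p C 2 → ∀ l u → ∃[ w ] (1 + p * u) ^ (p ^ l) ≡ 1 + p ^ suc l * (u + p * w)
lift-exponent {p} _ zero u = 0 , base p u
  where
  base : ∀ p u → (1 + p * u) * 1 ≡ 1 + p * 1 * (u + p * 0)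
  base = solve-∀
lift-exponent {p} p∣pC2 (suc l) u with lift-exponent p∣pC2 l u
... | w , eq with lift-exponent-step p∣pC2 l (u + p * w)
...   | w′ , eq′ = w + w′ , (begin
  a ^ (p * p ^ l)                        ≡⟨ m^[n*o]≡[m^o]^n a p (p ^ l) ⟩
  (a ^ p ^ l) ^ p                        ≡⟨ cong (_^ p) eq ⟩
  (1 + p ^ suc l * (u + p * w)) ^ p      ≡⟨ eq′ ⟩
  1 + p ^ suc (suc l) * (u + p * w + p * w′) ≡⟨ cong (λ v → 1 + p ^ suc (suc l) * v) (solve (u ∷ p ∷ w ∷ w′ ∷ [])) ⟩
  1 + p ^ suc (suc l) * (u + p * (w + w′))   ∎)
  where
  open ≡-Reasoning
  a : ℕ
  a = 1 + p * u

count : ℕ → ℕ → ℕ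
count n j = length (filter (λ m → coprime? m n) (upTo j))

count-suc : ∀ n j → count n (suc j) ≡ count n j + length (filter (λ m → coprime? m n) (j ∷ []))
count-suc n j = begin
  length (filter P? (upTo (suc j)))                       ≡⟨ cong (length ∘ filter P?) (upTo-∷ʳ j) ⟨
  length (filter P? (upTo j ++ j ∷ []))                   ≡⟨ cong length (filter-++ P? (upTo j) (j ∷ [])) ⟩
  length (filter P? (upTo j) ++ filter P? (j ∷ []))       ≡⟨ length-++ (filter P? (upTo j)) ⟩
  count n j + length (filter P? (j ∷ []))                  ∎
  where
  open ≡-Reasoning
  P? = λ m → coprime? m n

module _ {n : ℕ} (pr : Prime (suc n)) (l : ℕ) where
  private
    p P : ℕ
    p = suc n
    P = p ^ suc l

  count-∤ : ∀ j → p ∤ j → count P (suc j) ≡ suc (count P j)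
  count-∤ j p∤j = begin
    count P (suc j)                                              ≡⟨ count-suc P j ⟩
    count P j + length (filter (λ m → coprime? m P) (j ∷ []))    ≡⟨ cong (λ xs → count P j + length xs) (filter-accept (λ m → coprime? m P) j⊥P) ⟩
    count P j + 1                                                ≡⟨ +-comm (count P j) 1 ⟩
    suc (count P j)                                              ∎
    where
    open ≡-Reasoning
    j⊥P : Coprime j P
    j⊥P = coprime-^ʳ (suc l) (∤⇒coprime pr p∤j)

  count-∣ : ∀ j → p ∣ j → count P (suc j) ≡ count P j
  count-∣ j p∣j = begin
    count P (suc j)                                              ≡⟨ count-suc P j ⟩
    count P j + length (filter (λ m → coprime? m P) (j ∷ []))    ≡⟨ cong (λ xs → count P j + length xs) (filter-reject (λ m → coprime? m P) (λ j⊥P → coprime⇒∤ pr (m∣m*n (p ^ l)) j⊥P p∣j)) ⟩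
    count P j + 0                                                ≡⟨ +-identityʳ (count P j) ⟩
    count P j                                                    ∎
    where open ≡-Reasoning

  count-multiple : ∀ q → count P (q * p) ≡ q * n
  count-block : ∀ q r → r ≤ n → count P (suc (q * p + r)) ≡ q * n + r

  count-multiple zero    = refl
  count-multiple (suc q) = begin
    count P (suc (n + q * p))  ≡⟨ cong (count P ∘ suc) (+-comm n (q * p)) ⟩
    count P (suc (q * p + n))  ≡⟨ count-block q n ≤-refl ⟩
    q * n + n                  ≡⟨ +-comm (q * n) n ⟩
    n + q * n                  ∎
    where open ≡-Reasoning

  count-block q zero    _    = begin
    count P (suc (q * p + 0))  ≡⟨ count-∣ (q * p + 0) (subst (p ∣_) (sym (+-identityʳ (q * p))) (n∣m*n q)) ⟩
    count P (q * p + 0)        ≡⟨ cong (count P) (+-identityʳ (q * p)) ⟩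
    count P (q * p)            ≡⟨ count-multiple q ⟩
    q * n                      ≡⟨ +-identityʳ (q * n) ⟨
    q * n + 0                  ∎
    where open ≡-Reasoning
  count-block q (suc r) r<n = begin
    count P (suc (q * p + suc r))  ≡⟨ count-∤ (q * p + suc r) p∤j ⟩
    suc (count P (q * p + suc r))  ≡⟨ cong (suc ∘ count P) (+-suc (q * p) r) ⟩
    suc (count P (suc (q * p + r))) ≡⟨ cong suc (count-block q r (<⇒≤ r<n)) ⟩
    suc (q * n + r)                ≡⟨ +-suc (q * n) r ⟨
    q * n + suc r                  ∎
    where
    open ≡-Reasoning
    p∤j : p ∤ q * p + suc r
    p∤j p∣j = >⇒∤ (s≤s r<n) (∣m+n∣m⇒∣n p∣j (n∣m*n q))

φ-prime-power : ∀ {p} → Prime p → ∀ l → φ (p ^ suc l) ≡ p ^ l * (p ∸ 1)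
φ-prime-power {zero}  ()
φ-prime-power {suc n} pr l = trans (cong (count (suc n ^ suc l)) (*-comm (suc n) (suc n ^ l))) (count-multiple pr l (suc n ^ l))

euler : ∀ {p x} → Prime p → 2 < p → p ∤ x → ∀ l → ∃[ A ] x ^ φ (p ^ suc l) ≡ 1 + p ^ suc l * A
euler {p} {x} pr 2<p p∤x l with fermat-little pr p∤x
... | t , x^[p∸1]≡1+pt with lift-exponent (prime∣pCk pr z<s 2<p) l t
...   | w , eq = t + p * w , (begin
  x ^ φ (p ^ suc l)           ≡⟨ cong (x ^_) (φ-prime-power pr l) ⟩
  x ^ (p ^ l * (p ∸ 1))       ≡⟨ m^[n*o]≡[m^o]^n x (p ^ l) (p ∸ 1) ⟩
  (x ^ (p ∸ 1)) ^ (p ^ l)     ≡⟨ cong (_^ (p ^ l)) x^[p∸1]≡1+pt ⟩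
  (1 + p * t) ^ (p ^ l)       ≡⟨ eq ⟩
  1 + p ^ suc l * (t + p * w) ∎)
  where open ≡-Reasoning

[1+p]^φ-quotient-unit : ∀ {p} → Prime p → 2 < p → ∀ l → ∃[ c ] ((1 + p) ^ φ (p ^ suc l) ≡ 1 + p ^ suc l * c × p ∤ c)
[1+p]^φ-quotient-unit {zero} ()
[1+p]^φ-quotient-unit {suc n} pr 2<p l with lift-exponent (prime∣pCk pr z<s 2<p) l 1
... | w , eq with binomial-first-order (suc n ^ suc l * (1 + suc n * w)) n
...   | s , [1+y]^n≡ = c , (begin
  (1 + p) ^ φ M                      ≡⟨ cong ((1 + p) ^_) (φ-prime-power pr l) ⟩
  (1 + p) ^ (p ^ l * n)              ≡⟨ ^-*-assoc (1 + p) (p ^ l) n ⟨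
  ((1 + p) ^ p ^ l) ^ n              ≡⟨ cong (λ a → ((1 + a) ^ p ^ l) ^ n) (*-identityʳ p) ⟨
  ((1 + p * 1) ^ p ^ l) ^ n          ≡⟨ cong (_^ n) eq ⟩
  (1 + M * u) ^ n                    ≡⟨ [1+y]^n≡ ⟩
  1 + M * u * (n + M * u * s)        ≡⟨ cong suc (*-assoc M u _) ⟩
  1 + M * c                          ∎)
  , p∤c
  where
  open ≡-Reasoning
  p M u c : ℕ
  p = suc n
  M = p ^ suc l
  u = 1 + p * w
  c = u * (n + M * u * s)
  1+c≡p*X : 1 + c ≡ p * (1 + w * n + p ^ l * u * u * s)
  1+c≡p*X = factor-p n w (p ^ l) s
    where
    factor-p : ∀ n w P s → let p = 1 + n ; u = 1 + p * w in
      1 + u * (n + p * P * u * s) ≡ p * (1 + w * n + P * u * u * s)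
    factor-p = solve-∀
  p∤c : p ∤ c
  p∤c p∣c = >⇒∤ (prime>1 pr) (∣m+n∣m⇒∣n (subst (p ∣_) (sym (trans (+-comm c 1) 1+c≡p*X)) (m∣m*n _)) p∣c)

module OddPrimePower {p : ℕ} (pr : Prime p) (2<p : 2 < p) (l k : ℕ) (ℓ≤k : suc l ≤ k) (k≤2ℓ : k ≤ 2 * suc l) where

  ℓ M N : ℕ
  ℓ = suc l
  M = p ^ ℓ
  N = p ^ (k ∸ ℓ)

  instance
    p≢0 : NonZero p
    p≢0 = prime⇒nonZero pr
    M≢0 : NonZero M
    M≢0 = m^n≢0 p ℓ
    N≢0 : NonZero N
    N≢0 = m^n≢0 p (k ∸ ℓ)
    p^k≢0 : NonZero (p ^ k)
    p^k≢0 = m^n≢0 p k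

  p^k≡M*N : p ^ k ≡ M * N
  p^k≡M*N = m^o≡m^n*m^[o∸n] p ℓ≤k

  N∣M : N ∣ M
  N∣M = m^n∣m^o p (subst (k ∸ ℓ ≤_) (+-identityʳ ℓ) (m≤n+o⇒m∸n≤o k ℓ k≤2ℓ))

  e≡A%N : ∀ {x A} → x ^ φ M ≡ 1 + M * A → e p k ℓ x ≡ A % N
  e≡A%N {x} {A} x^φ≡1+MA = begin
    ((x ^ φ M ∸ 1) / M) % N  ≡⟨ cong (λ a → ((a ∸ 1) / M) % N) x^φ≡1+MA ⟩
    ((M * A) / M) % N        ≡⟨ cong (λ a → (a / M) % N) (*-comm M A) ⟩
    ((A * M) / M) % N        ≡⟨ cong (_% N) (m*n/n≡m A M) ⟩
    A % N                    ∎
    where open ≡-Reasoning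

  unit-quotient : ∀ {x} → Coprime x p → ∃[ A ] x ^ φ M ≡ 1 + M * A
  unit-quotient x⊥p = euler pr 2<p (coprime⇒∤ pr ∣-refl x⊥p) l

  exact : (x : ℕ) → Coprime x p → M ∣ (x ^ φ M ∸ 1)
  exact x x⊥p with unit-quotient x⊥p
  ... | A , x^φ≡1+MA = divides A (trans (cong (_∸ 1) x^φ≡1+MA) (*-comm M A))

  well-defined : (x y : ℕ) → Coprime x p → Coprime y p → x % (p ^ k) ≡ y % (p ^ k) → e p k ℓ x ≡ e p k ℓ y
  well-defined x y x⊥p y⊥p x≡y with unit-quotient x⊥p | unit-quotient y⊥p
  ... | A , x^φ≡1+MA | B , y^φ≡1+MB = begin
    e p k ℓ x  ≡⟨ e≡A%N x^φ≡1+MA ⟩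
    A % N      ≡⟨ %-cancel-*ˡ M N p^k≡M*N 1+MA≡1+MB ⟩
    B % N      ≡⟨ e≡A%N y^φ≡1+MB ⟨
    e p k ℓ y  ∎
    where
    open ≡-Reasoning
    1+MA≡1+MB : (1 + M * A) % (p ^ k) ≡ (1 + M * B) % (p ^ k)
    1+MA≡1+MB = subst₂ (λ a b → a % (p ^ k) ≡ b % (p ^ k)) x^φ≡1+MA y^φ≡1+MB (%-cong-^ (p ^ k) x≡y (φ M))

  homomorphic : (x y : ℕ) → Coprime x p → Coprime y p → e p k ℓ (x * y) ≡ (e p k ℓ x + e p k ℓ y) % N
  homomorphic x y x⊥p y⊥p with unit-quotient x⊥p | unit-quotient y⊥p
  ... | A , x^φ≡1+MA | B , y^φ≡1+MB = begin
    e p k ℓ (x * y)               ≡⟨ e≡A%N [xy]^φ≡ ⟩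
    (A + B + M * (A * B)) % N     ≡⟨ ∣⇒[m+dk]%n≡m%n (A + B) (A * B) N∣M ⟩
    (A + B) % N                   ≡⟨ %-distribˡ-+ A B N ⟩
    (A % N + B % N) % N           ≡⟨ cong₂ (λ a b → (a + b) % N) (e≡A%N x^φ≡1+MA) (e≡A%N y^φ≡1+MB) ⟨
    (e p k ℓ x + e p k ℓ y) % N   ∎
    where
    open ≡-Reasoning
    expand : ∀ M A B → (1 + M * A) * (1 + M * B) ≡ 1 + M * (A + B + M * (A * B))
    expand = solve-∀
    [xy]^φ≡ : (x * y) ^ φ M ≡ 1 + M * (A + B + M * (A * B))
    [xy]^φ≡ = begin
      (x * y) ^ φ M                   ≡⟨ ^-distrib-* x y (φ M) ⟩
      x ^ φ M * y ^ φ M               ≡⟨ cong₂ _*_ x^φ≡1+MA y^φ≡1+MB ⟩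
      (1 + M * A) * (1 + M * B)       ≡⟨ expand M A B ⟩
      1 + M * (A + B + M * (A * B))   ∎

  e-^ : ∀ {x A} → x ^ φ M ≡ 1 + M * A → ∀ m → e p k ℓ (x ^ m) ≡ (m * A) % N
  e-^ {x} {A} x^φ≡1+MA m with binomial-first-order (M * A) m
  ... | s , [1+MA]^m≡ = begin
    e p k ℓ (x ^ m)                   ≡⟨ e≡A%N [x^m]^φ≡ ⟩
    (m * A + M * (A * A * s)) % N     ≡⟨ ∣⇒[m+dk]%n≡m%n (m * A) (A * A * s) N∣M ⟩
    (m * A) % N                       ∎
    where
    open ≡-Reasoning
    regroup : ∀ M A m s → 1 + M * A * (m + M * A * s) ≡ 1 + M * (m * A + M * (A * A * s))
    regroup = solve-∀
    [x^m]^φ≡ : (x ^ m) ^ φ M ≡ 1 + M * (m * A + M * (A * A * s))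
    [x^m]^φ≡ = begin
      (x ^ m) ^ φ M                       ≡⟨ ^-*-assoc x m (φ M) ⟩
      x ^ (m * φ M)                       ≡⟨ m^[n*o]≡[m^o]^n x m (φ M) ⟩
      (x ^ φ M) ^ m                       ≡⟨ cong (_^ m) x^φ≡1+MA ⟩
      (1 + M * A) ^ m                     ≡⟨ [1+MA]^m≡ ⟩
      1 + M * A * (m + M * A * s)         ≡⟨ regroup M A m s ⟩
      1 + M * (m * A + M * (A * A * s))   ∎

  surjective : (z : ℕ) → z < N → ∃[ x ] (Coprime x p × e p k ℓ x ≡ z)
  surjective z z<N with [1+p]^φ-quotient-unit pr 2<p l
  ... | c , [1+p]^φ≡1+Mc , p∤c with linear-congruence (coprime-^ʳ (k ∸ ℓ) (∤⇒coprime pr p∤c)) z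
  ...   | m , mc≡z = (1 + p) ^ m , [1+p]^m⊥p , (begin
    e p k ℓ ((1 + p) ^ m)   ≡⟨ e-^ [1+p]^φ≡1+Mc m ⟩
    (m * c) % N             ≡⟨ mc≡z ⟩
    z % N                   ≡⟨ m<n⇒m%n≡m z<N ⟩
    z                       ∎)
    where
    open ≡-Reasoning
    1+p⊥p : Coprime (1 + p) p
    1+p⊥p = subst (λ a → Coprime a p) (+-comm p 1) (coprime-+ (1-coprimeTo p))
    [1+p]^m⊥p : Coprime ((1 + p) ^ m) p
    [1+p]^m⊥p = coprime-sym (coprime-^ʳ m (coprime-sym 1+p⊥p))

proposition1p2 :
    (p k ℓ : ℕ) .{{_ : NonZero p}} → Prime p → p ≢ 2 → 1 ≤ ℓ → ℓ ≤ k → k ≤ 2 * ℓ →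
      -- the defining quotient is exact
      ((x : ℕ) → Coprime x p → (p ^ ℓ) ∣ (x ^ φ (p ^ ℓ) ∸ 1))
      -- well-defined on (ℤ/p^kℤ)^×
      × ((x y : ℕ) → Coprime x p → Coprime y p →
          _%_ x (p ^ k) {{m^n≢0 p k}} ≡ _%_ y (p ^ k) {{m^n≢0 p k}} →
          e p k ℓ x ≡ e p k ℓ y)
      -- homomorphism (ℤ/p^kℤ)^× → ℤ/p^(k-ℓ)ℤ
      × ((x y : ℕ) → Coprime x p → Coprime y p →
          e p k ℓ (x * y) ≡ _%_ (e p k ℓ x + e p k ℓ y) (p ^ (k ∸ ℓ)) {{m^n≢0 p (k ∸ ℓ)}})
      -- surjective
      × ((z : ℕ) → z < p ^ (k ∸ ℓ) → ∃[ x ] (Coprime x p × e p k ℓ x ≡ z))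
proposition1p2 p k zero    _  _   ()  _   _
proposition1p2 p k (suc l) pr p≢2 _ ℓ≤k k≤2ℓ = exact , well-defined , homomorphic , surjective
  where
  2<p : 2 < p
  2<p = ≤∧≢⇒< (prime>1 pr) (p≢2 ∘ sym)
  open OddPrimePower pr 2<p l k ℓ≤k k≤2ℓ
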